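{- Let $X$ be a well-quasi-ordered poset. Let $L = \mathrm{Idl}(X) \setminus \{{\downarrow} x \mid x \in X\}$. Let $\gamma$ send each $x \in X$ to ${\downarrow} x$ and each $I \in L$ to $I$. Let $\preceq$ be defined on $L \cup X$ by $z \preceq z'$ iff $\gamma(z) \subseteq \gamma(z')$. Then: (a) $(L, \preceq, \gamma)$ is a weak adequate domain of limits on $X$; (b) for every weak adequate domain of limits $(L', \preceq', \gamma')$ on $X$, every ideal of $X$ belongs to $\gamma'(L' \cup X)$. In this sense $\mathrm{Idl}(X)$, which coincides with the set $\mathcal{S}(X_a)$ of irreducible closed subsets of $X$ under the Alexandroff topology, is the smallest weak adequate domain of limits on $X$.
   Context: For a poset $(X,\le)$, ${\downarrow} E = \{y \mid \exists x\in E,\ y \le x\}$ and ${\downarrow} x = {\downarrow}\{x\}$. An ideal of $X$ is a nonempty downward closed subset $I$ that is directed: any two elements of $I$ have an upper bound in $I$. $\mathrm{Idl}(X)$ is the set of ideals, ordered by inclusion. $X_a$ is $X$ with the Alexandroff topology, whose opens are the upward closed sets; its closed sets are the downward closed sets. A closed set $F$ is irreducible if $F\ne\emptyset$ and $F \subseteq F_1 \cup F_2$ with $F_1,F_2$ closed implies $F\subseteq F_1$ or $F \subseteq F_2$. A well quasi-ordering is a well-founded quasi-ordering with no infinite antichain. A weak adequate domain of limits (WADL) on $X$ is a triple $(L, \preceq, \gamma)$ satisfying the following. - $L$ is a set disjoint from $X$, $\preceq$ is a binary relation on $L\cup X$, and $\gamma: L \cup X \to \mathcal{P}(X)$. - $(\mathrm{L}_1)$: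 each $\gamma(z)$ is downward closed, and $\gamma(x) = {\downarrow} x$ for $x \in X$. - $(\mathrm{L}_3)$: $z \preceq z'$ iff $\gamma(z)\subseteq\gamma(z')$. - $(\mathrm{L}_4)$: every downward closed $D\subseteq X$ equals $\bigcup_{z\in E}\gamma(z)$ for some finite $E \subseteq L\cup X$. Elements of $L$ are assumed distinct from elements of $X$, e.g. by tagging. -}

module Defs where

open import Level using (Level; _⊔_; suc)
open import Data.Nat using (ℕ)
open import Data.Product using (Σ; ∃; _×_; _,_; proj₁)
open import Data.Sum using (_⊎_; inj₁; inj₂)
open import Data.List using (List)
open import Data.List.Relation.Unary.Any using (Any)
open import Relation.Nullary using (¬_)
open import Relation.Unary using (Pred; _⊆_; _≐_; _∪_)
open import Relation.Binary using (Poset; Rel)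
open import Relation.Binary.PropositionalEquality using (_≢_)
open import Induction.WellFounded using (WellFounded)

module _ {ℓ : Level} (P : Poset ℓ ℓ ℓ) where
  open Poset P renaming (Carrier to X)

  Subset : Set (suc ℓ)
  Subset = Pred X ℓ

  -- downward closed subsets = closed sets of the Alexandroff topology X_a
  DownClosed : Subset → Set ℓ
  DownClosed D = ∀ {x y} → y ≤ x → D x → D y

  ↓ : X → Subset
  ↓ x = λ y → y ≤ x

  IsIdeal : Subset → Set ℓ
  IsIdeal I = (∃ λ x → I x) × DownClosed I
              × (∀ {x y} → I x → I y → ∃ λ z → I z × x ≤ z × y ≤ z)

  IsIrreducibleClosed : Subset → Set (suc ℓ)
  IsIrreducibleClosed F = DownClosed F × (∃ λ x → F x)
    × (∀ (F₁ F₂ : Subset) → DownClosed F₁ → DownClosed F₂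
         → F ⊆ (F₁ ∪ F₂) → (F ⊆ F₁) ⊎ (F ⊆ F₂))

  _<ₛ_ : Rel X ℓ
  x <ₛ y = x ≤ y × ¬ (x ≈ y)

  InfiniteAntichain : Set ℓ
  InfiniteAntichain = Σ (ℕ → X) λ f → ∀ i j → i ≢ j → ¬ (f i ≤ f j)

  IsWQO : Set ℓ
  IsWQO = WellFounded _<ₛ_ × ¬ InfiniteAntichain

  -- weak adequate domain of limits (L, ≼, γ) on X; L is tagged by ⊎
  record IsWADL {a r : Level} {L : Set a} (_≼_ : Rel (L ⊎ X) r)
                (γ : L ⊎ X → Subset) : Set (suc ℓ ⊔ a ⊔ r) where
    field
      L1-down : ∀ z → DownClosed (γ z)
      L1-pt   : ∀ x → γ (inj₂ x) ≐ ↓ x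
      L3      : ∀ z z' → (z ≼ z' → γ z ⊆ γ z') × (γ z ⊆ γ z' → z ≼ z')
      L4      : ∀ (D : Subset) → DownClosed D →
                ∃ λ (E : List (L ⊎ X)) → D ≐ (λ y → Any (λ z → γ z y) E)

  IdlL : Set (suc ℓ)
  IdlL = Σ Subset λ I → IsIdeal I × ¬ (∃ λ x → I ≐ ↓ x)

  γIdl : IdlL ⊎ X → Subset
  γIdl (inj₁ I) = proj₁ I
  γIdl (inj₂ x) = ↓ x

  _≼Idl_ : Rel (IdlL ⊎ X) ℓ
  z ≼Idl z' = γIdl z ⊆ γIdl z'

-- Primeness: an ideal covered by finitely many downward closed sets lies in
-- one of them (an upper bound of points escaping each would escape all).
-- This gives "ideal ⇒ irreducible" and part (b): by (L₄) an ideal is a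
-- finite union of limits γ'(z), hence equal to one of them.
-- Decomposition, i.e. (L₄) for ideals: a downward closed set that is not a
-- finite union of ideals is non-empty and undirected, so it splits into two
-- proper downward closed parts, one of which is again not such a union.
-- Iterating yields a strictly descending chain whose witness points form a
-- bad sequence, impossible in a wqo (terminal indices are cofinal by
-- well-foundedness, and along them a bad sequence is an antichain).

module Submission where

open import Defs
open import Level using (Level; _⊔_; suc; Lift; lift; lower)
open import Function using (id; _∘_)
open import Data.Product using (∃; ∃₂; _×_; _,_; proj₁)
open import Data.Sum using (_⊎_; inj₁; inj₂)
open import Data.Empty using (⊥; ⊥-elim)
open import Data.Nat using (ℕ; zero; _<_; _≤′_; ≤′-reflexive; ≤′-step)
  renaming (suc to 1+; _≤_ to _≤ℕ_)
open import Data.Nat.Properties using (≤⇒≤′; ≤-refl; ≤-trans; <⇒≤; <-≤-trans; <-cmp)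
open import Data.List using (List; []; _∷_; _++_)
open import Data.List.Relation.Unary.Any using (Any; here; there; any?)
open import Data.List.Relation.Unary.Any.Properties using (++⁺ˡ; ++⁺ʳ; ++⁻)
open import Data.List.Relation.Unary.All as All using (All; []; _∷_)
open import Data.List.Relation.Unary.All.Properties using (¬Any⇒All¬)
open import Data.List.Membership.Propositional using (find; lose)
open import Relation.Nullary using (Dec; yes; no; ¬_)
open import Relation.Nullary.Decidable using (map′; decidable-stable)
open import Relation.Unary using (Pred; _≐_; _⊆_; _∪_)
open import Relation.Unary.Properties using (≐-refl)
open import Relation.Binary using (Poset; Rel; Reflexive; Transitive; tri<; tri≈; tri>)
open import Relation.Binary.PropositionalEquality using (refl; _≢_)
open import Function.Bundles using (_⇔_; mk⇔)
open import Axiom.ExcludedMiddle using (ExcludedMiddle)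
open import Axiom.DoubleNegationElimination using (em⇒dne)
open import Induction.WellFounded using (WellFounded; Acc; acc)

successor-chain : ∀ {a r} {A : Set a} (R : Rel A r) → Reflexive R → Transitive R →
                  (s : ℕ → A) → (∀ n → R (s n) (s (1+ n))) →
                  ∀ {i j} → i ≤ℕ j → R (s i) (s j)
successor-chain R r-refl r-trans s step i≤j = along (≤⇒≤′ i≤j)
  where
    along : ∀ {i j} → i ≤′ j → R (s i) (s j)
    along (≤′-reflexive refl) = r-refl
    along (≤′-step i≤′j)      = r-trans (along i≤′j) (step _)

module Constructive {ℓ : Level} (P : Poset ℓ ℓ ℓ) where
  open Poset P renaming (Carrier to X; refl to ≤-reflexive; trans to ≤-transitive)

  ⋃ : ∀ {a} {A : Set a} → (A → Subset P) → List A → Pred X (a ⊔ ℓ)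
  ⋃ γ E y = Any (λ z → γ z y) E

  ⋃-down : ∀ {a} {A : Set a} {γ : A → Subset P} {E : List A} →
           All (λ z → DownClosed P (γ z)) E → ∀ {x y} → y ≤ x → ⋃ γ E x → ⋃ γ E y
  ⋃-down (down ∷ _)     y≤x (here p)  = here (down y≤x p)
  ⋃-down (_ ∷ downs)   y≤x (there p) = there (⋃-down downs y≤x p)

  UpperBoundIn : Subset P → X → X → Set ℓ
  UpperBoundIn D x y = ∃ λ z → D z × x ≤ z × y ≤ z

  Directed : Subset P → Set ℓ
  Directed D = ∀ {x y} → D x → D y → UpperBoundIn D x y

  ideal-escapes : ∀ {a} {A : Set a} {γ : A → Subset P} {I : Subset P} →
                  IsIdeal P I → (E : List A) → All (λ z → DownClosed P (γ z)) E →
                  All (λ z → ∃ λ x → I x × ¬ γ z x) E → ∃ λ u → I u × ¬ ⋃ γ E u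
  ideal-escapes ((x , Ix) , _ , _) [] [] [] = x , Ix , λ ()
  ideal-escapes {γ = γ} idl@(_ , _ , directed) (z ∷ E) (down ∷ downs) ((x , Ix , x∉) ∷ escapes)
    with ideal-escapes idl E downs escapes
  ... | u , Iu , u∉ with directed Ix Iu
  ...   | w , Iw , x≤w , u≤w = w , Iw , w∉
    where
      w∉ : ¬ ⋃ γ (z ∷ E) w
      w∉ (here w∈)  = x∉ (down x≤w w∈)
      w∉ (there w∈) = u∉ (⋃-down downs u≤w w∈)

  Avoid : Subset P → X → Subset P
  Avoid D x z = D z × ¬ x ≤ z

  avoid-down : ∀ {D} x → DownClosed P D → DownClosed P (Avoid D x)
  avoid-down x down y≤z (Dz , x≰z) = down y≤z Dz , λ x≤y → x≰z (≤-transitive x≤y y≤z)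

  avoid-misses : ∀ {D} x → ¬ Avoid D x x
  avoid-misses x (_ , x≰x) = x≰x ≤-reflexive

  Bad : (ℕ → X) → Set ℓ
  Bad f = ∀ {i j} → i < j → ¬ f i ≤ f j

  descending⇒bad : (D : ℕ → Subset P) (x : ℕ → X) →
                   (∀ n → DownClosed P (D n)) → (∀ n → D (1+ n) ⊆ D n) →
                   (∀ n → D n (x n)) → (∀ n → ¬ D (1+ n) (x n)) → Bad x
  descending⇒bad D x down shrinks x∈ x∉ {i} {j} i<j xi≤xj =
    x∉ i (down (1+ i) xi≤xj (D-antitone i<j (x∈ j)))
    where
      D-antitone : ∀ {m n} → m ≤ℕ n → D n ⊆ D m
      D-antitone = successor-chain (λ A B → B ⊆ A) (λ Ax → Ax)
                                   (λ B⊆A C⊆B Cx → B⊆A (C⊆B Cx)) D shrinks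

  Terminal : (ℕ → X) → ℕ → Set ℓ
  Terminal f i = ∀ {j} → i < j → ¬ (_<ₛ_ P (f j) (f i))

  no-descending-tail : WellFounded (_<ₛ_ P) → (f : ℕ → X) (N : ℕ) →
                       ¬ (∀ {i} → N ≤ℕ i → ∃ λ j → i < j × _<ₛ_ P (f j) (f i))
  no-descending-tail wf f N descend = from N ≤-refl (wf (f N))
    where
      from : ∀ i → N ≤ℕ i → Acc (_<ₛ_ P) (f i) → ⊥
      from i N≤i (acc smaller) with descend N≤i
      ... | j , i<j , fj<fi = from j (≤-trans N≤i (<⇒≤ i<j)) (smaller fj<fi)

module Classical {ℓ : Level} (EM : ExcludedMiddle (suc ℓ)) (P : Poset ℓ ℓ ℓ) where
  open Poset P renaming (Carrier to X; refl to ≤-reflexive; trans to ≤-transitive)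
  open Constructive P

  decide : (A : Set ℓ) → Dec A
  decide A = map′ lower lift (EM {Lift (suc ℓ) A})

  stable : {A : Set ℓ} → ¬ ¬ A → A
  stable = decidable-stable (decide _)

  ¬⊆⇒escape : {A B : Subset P} → ¬ (A ⊆ B) → ∃ λ x → A x × ¬ B x
  ¬⊆⇒escape A⊈B =
    stable λ none → A⊈B λ {x} Ax → stable λ ¬Bx → none (x , Ax , ¬Bx)

  ideal-prime : ∀ {a} {A : Set a} {γ : A → Subset P} {I : Subset P} →
                IsIdeal P I → (E : List A) → All (λ z → DownClosed P (γ z)) E →
                I ⊆ ⋃ γ E → Any (λ z → I ⊆ γ z) E
  ideal-prime {γ = γ} {I} idl E downs I⊆⋃ with any? (λ z → decide (I ⊆ γ z)) E
  ... | yes inside = inside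
  ... | no outside with ideal-escapes idl E downs (All.map ¬⊆⇒escape (¬Any⇒All¬ E outside))
  ...   | u , Iu , u∉ = ⊥-elim (u∉ (I⊆⋃ Iu))

  directed-or-split : (D : Subset P) →
                      Directed D ⊎ ∃₂ λ x y → D x × D y × ¬ UpperBoundIn D x y
  directed-or-split D with decide (∃₂ λ x y → D x × D y × ¬ UpperBoundIn D x y)
  ... | yes pair = inj₂ pair
  ... | no none  = inj₁ λ {x} {y} Dx Dy → stable λ noBound → none (x , y , Dx , Dy , noBound)

  split : ∀ {D x y} → ¬ UpperBoundIn D x y → D ⊆ (Avoid D x ∪ Avoid D y)
  split {x = x} {y} noBound {z} Dz with decide (x ≤ z) | decide (y ≤ z)
  ... | no x≰z  | _       = inj₁ (Dz , x≰z)
  ... | yes _   | no y≰z  = inj₂ (Dz , y≰z)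
  ... | yes x≤z | yes y≤z = ⊥-elim (noBound (z , Dz , x≤z , y≤z))

  -- Ideals are irreducible: the binary case of primeness.
  ideal⇒irreducible : ∀ I → IsIdeal P I → IsIrreducibleClosed P I
  ideal⇒irreducible I idl@(inhabited , down , _) = down , inhabited , irreducible
    where
      irreducible : ∀ F₁ F₂ → DownClosed P F₁ → DownClosed P F₂ →
                    I ⊆ (F₁ ∪ F₂) → (I ⊆ F₁) ⊎ (I ⊆ F₂)
      irreducible F₁ F₂ down₁ down₂ I⊆∪ =
        from-pair (ideal-prime idl (F₁ ∷ F₂ ∷ []) (down₁ ∷ down₂ ∷ []) (to-pair ∘ I⊆∪))
        where
          to-pair : (F₁ ∪ F₂) ⊆ ⋃ id (F₁ ∷ F₂ ∷ [])
          to-pair (inj₁ F₁x) = here F₁x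
          to-pair (inj₂ F₂x) = there (here F₂x)
          from-pair : Any (I ⊆_) (F₁ ∷ F₂ ∷ []) → (I ⊆ F₁) ⊎ (I ⊆ F₂)
          from-pair (here I⊆F₁)         = inj₁ I⊆F₁
          from-pair (there (here I⊆F₂)) = inj₂ I⊆F₂

  -- Irreducible closed sets are directed: an undirected pair would split
  -- the set into two Avoid sets, neither of which contains it.
  irreducible⇒ideal : ∀ I → IsIrreducibleClosed P I → IsIdeal P I
  irreducible⇒ideal I (down , inhabited , irreducible) =
    inhabited , down , directed (directed-or-split I)
    where
      directed : Directed I ⊎ ∃₂ (λ x y → I x × I y × ¬ UpperBoundIn I x y) → Directed I
      directed (inj₁ dir) = dir
      directed (inj₂ (x , y , Ix , Iy , noBound))
        with irreducible (Avoid I x) (Avoid I y) (avoid-down x down) (avoid-down y down)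
                         (split noBound)
      ... | inj₁ I⊆Ax = ⊥-elim (avoid-misses {I} x (I⊆Ax Ix))
      ... | inj₂ I⊆Ay = ⊥-elim (avoid-misses {I} y (I⊆Ay Iy))

  terminals-cofinal : WellFounded (_<ₛ_ P) → (f : ℕ → X) →
                      ∀ N → ∃ λ i → N ≤ℕ i × Terminal f i
  terminals-cofinal wf f N = stable λ none →
    no-descending-tail wf f N λ {i} N≤i →
      stable λ noDescent → none (i , N≤i , λ {j} i<j fj<fi → noDescent (j , i<j , fj<fi))

  bad⇒antichain : (f : ℕ → X) → Bad f → (∀ N → ∃ λ i → N ≤ℕ i × Terminal f i) →
                  InfiniteAntichain P
  bad⇒antichain f bad terminal = g , antichain
    where
      idx : ℕ → ℕ
      idx zero   = let (i , _) = terminal 0 in i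
      idx (1+ k) = let (i , _) = terminal (1+ (idx k)) in i

      idx-terminal : ∀ k → Terminal f (idx k)
      idx-terminal zero   = let (_ , _ , t) = terminal 0 in t
      idx-terminal (1+ k) = let (_ , _ , t) = terminal (1+ (idx k)) in t

      idx-step : ∀ k → idx k < idx (1+ k)
      idx-step k = let (_ , after , _) = terminal (1+ (idx k)) in after

      idx-mono : ∀ {i j} → i < j → idx i < idx j
      idx-mono {i} i<j = <-≤-trans (idx-step i)
        (successor-chain _≤ℕ_ ≤-refl ≤-trans idx (λ k → <⇒≤ (idx-step k)) i<j)

      g : ℕ → X
      g k = f (idx k)

      antichain : ∀ i j → i ≢ j → ¬ g i ≤ g j
      antichain i j i≢j gi≤gj with <-cmp i j
      ... | tri< i<j _ _ = bad (idx-mono i<j) gi≤gj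
      ... | tri≈ _ i≡j _ = i≢j i≡j
      ... | tri> _ _ j<i with decide (g i ≈ g j)
      ...   | yes gi≈gj = bad (idx-mono j<i) (reflexive (Eq.sym gi≈gj))
      ...   | no gi≉gj  = idx-terminal j (idx-mono j<i) (gi≤gj , gi≉gj)

  wqo⇒no-bad : IsWQO P → (f : ℕ → X) → ¬ Bad f
  wqo⇒no-bad (wf , noAntichain) f bad =
    noAntichain (bad⇒antichain f bad (terminals-cofinal wf f))

  FinUnion : Subset P → Set (suc ℓ)
  FinUnion D = ∃ λ (E : List (IdlL P ⊎ X)) → D ≐ ⋃ (γIdl P) E

  finUnion-empty : ∀ {D} → ¬ (∃ λ x → D x) → FinUnion D
  finUnion-empty empty = [] , (λ {x} Dx → ⊥-elim (empty (x , Dx))) , λ ()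

  finUnion-ideal : ∀ {D} → IsIdeal P D → FinUnion D
  finUnion-ideal {D} idl with decide (∃ λ x → D ≐ ↓ P x)
  ... | yes (x , D⊆↓x , ↓x⊆D) = inj₂ x ∷ [] , (λ Dy → here (D⊆↓x Dy)) ,
                                  λ { (here y≤x) → ↓x⊆D y≤x }
  ... | no notPrincipal = inj₁ (D , idl , notPrincipal) ∷ [] , here , λ { (here Dy) → Dy }

  finUnion-∪ : ∀ {D F₁ F₂} → D ⊆ (F₁ ∪ F₂) → F₁ ⊆ D → F₂ ⊆ D →
               FinUnion F₁ → FinUnion F₂ → FinUnion D
  finUnion-∪ {D} D⊆∪ F₁⊆D F₂⊆D (E₁ , F₁⊆E₁ , E₁⊆F₁) (E₂ , F₂⊆E₂ , E₂⊆F₂) =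
    E₁ ++ E₂ , into , out
    where
      into : D ⊆ ⋃ (γIdl P) (E₁ ++ E₂)
      into Dx with D⊆∪ Dx
      ... | inj₁ F₁x = ++⁺ˡ (F₁⊆E₁ F₁x)
      ... | inj₂ F₂x = ++⁺ʳ E₁ (F₂⊆E₂ F₂x)
      out : ⋃ (γIdl P) (E₁ ++ E₂) ⊆ D
      out x∈ with ++⁻ E₁ x∈
      ... | inj₁ x∈E₁ = F₁⊆D (E₁⊆F₁ x∈E₁)
      ... | inj₂ x∈E₂ = F₂⊆D (E₂⊆F₂ x∈E₂)

  record Indecomposable : Set (suc ℓ) where
    field
      set            : Subset P
      down           : DownClosed P set
      not-finUnion   : ¬ FinUnion set

  record Shrinking (D : Indecomposable) : Set (suc ℓ) where
    field
      smaller   : Indecomposable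
      inside    : Indecomposable.set smaller ⊆ Indecomposable.set D
      point     : X
      point∈    : Indecomposable.set D point
      point∉    : ¬ Indecomposable.set smaller point

  shrink-avoiding : ∀ D {x} → Indecomposable.set D x →
                    ¬ FinUnion (Avoid (Indecomposable.set D) x) → Shrinking D
  shrink-avoiding D {x} Dx avoid-indecomposable = record
    { smaller = record { set = Avoid set x ; down = avoid-down x down
                       ; not-finUnion = avoid-indecomposable }
    ; inside  = proj₁
    ; point   = x
    ; point∈  = Dx
    ; point∉  = avoid-misses {set} x }
    where open Indecomposable D

  -- An indecomposable set is non-empty and not directed (otherwise it would
  -- be empty or an ideal); of the two Avoid sets covering it, one is again
  -- indecomposable.
  shrink : (D : Indecomposable) → Shrinking D
  shrink D@record { set = S ; down = down ; not-finUnion = indecomposable }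
    with decide (∃ λ x → S x) | directed-or-split S
  ... | no empty      | _        = ⊥-elim (indecomposable (finUnion-empty empty))
  ... | yes inhabited | inj₁ dir = ⊥-elim (indecomposable (finUnion-ideal (inhabited , down , dir)))
  ... | yes _         | inj₂ (x , y , Sx , Sy , noBound)
    with EM {FinUnion (Avoid S x)} | EM {FinUnion (Avoid S y)}
  ...   | no  x-indecomposable | _                   = shrink-avoiding D Sx x-indecomposable
  ...   | yes _                | no y-indecomposable = shrink-avoiding D Sy y-indecomposable
  ...   | yes x-decomposed     | yes y-decomposed    =
    ⊥-elim (indecomposable (finUnion-∪ (split noBound) proj₁ proj₁ x-decomposed y-decomposed))

  -- In a wqo there is no indecomposable set: iterated shrinking would
  -- produce a strictly descending chain, hence a bad sequence.
  no-indecomposable : IsWQO P → ¬ Indecomposable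
  no-indecomposable wqo D =
    wqo⇒no-bad wqo point (descending⇒bad set point down inside point∈ point∉)
    where
      chain : ℕ → Indecomposable
      chain zero   = D
      chain (1+ n) = Shrinking.smaller (shrink (chain n))

      set : ℕ → Subset P
      set n = Indecomposable.set (chain n)

      down : ∀ n → DownClosed P (set n)
      down n = Indecomposable.down (chain n)

      open module Step n = Shrinking (shrink (chain n)) using (inside; point; point∈; point∉)

  decomposition : IsWQO P → ∀ D → DownClosed P D → FinUnion D
  decomposition wqo D down = em⇒dne EM λ not-finUnion →
    no-indecomposable wqo (record { set = D ; down = down ; not-finUnion = not-finUnion })

  canonical-WADL : IsWQO P → IsWADL P (_≼Idl_ P) (γIdl P)
  canonical-WADL wqo = record
    { L1-down = γ-down
    ; L1-pt   = λ x → ≐-refl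
    ; L3      = λ z z' → id , id
    ; L4      = decomposition wqo }
    where
      γ-down : ∀ z → DownClosed P (γIdl P z)
      γ-down (inj₁ (_ , (_ , down , _) , _)) = down
      γ-down (inj₂ x)                        = ≤-transitive

  -- Part (b): every ideal is a limit of any weak adequate domain of limits,
  -- because by (L₄) it is a finite union of limits and by primeness it is
  -- contained in one of them.
  ideal-is-limit : ∀ {a r} {L' : Set a} (≼' : Rel (L' ⊎ X) r) (γ' : L' ⊎ X → Subset P) →
                   IsWADL P ≼' γ' → ∀ I → IsIdeal P I → ∃ λ z → γ' z ≐ I
  ideal-is-limit ≼' γ' W I idl@(_ , down , _) with IsWADL.L4 W I down
  ... | E , I⊆⋃ , ⋃⊆I with find (ideal-prime idl E (All.tabulate λ {z} _ → IsWADL.L1-down W z) I⊆⋃)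
  ...   | z , z∈E , I⊆γz = z , (λ γzx → ⋃⊆I (lose z∈E γzx)) , I⊆γz

theorem3p4 : ∀ {ℓ a r : Level} → ExcludedMiddle (suc ℓ) →
    (P : Poset ℓ ℓ ℓ) → IsWQO P →
    IsWADL P (_≼Idl_ P) (γIdl P)
    × (∀ {L' : Set a} (≼' : Rel (L' ⊎ Poset.Carrier P) r)
         (γ' : L' ⊎ Poset.Carrier P → Subset P) →
         IsWADL P ≼' γ' →
         ∀ (I : Subset P) → IsIdeal P I → ∃ λ z → γ' z ≐ I)
    × (∀ (I : Subset P) → IsIdeal P I ⇔ IsIrreducibleClosed P I)
theorem3p4 EM P wqo =
  canonical-WADL wqo ,
  ideal-is-limit ,
  λ I → mk⇔ (ideal⇒irreducible I) (irreducible⇒ideal I)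
  where open Classical EM P
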